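{- If $\Gamma \vdash V = W : A$ is derivable in $\lambda_{\mathrm{eff}}$, then $[\![V]\!] = [\![W]\!]$ in every $\lambda_{\mathrm{eff}}$-model. Similarly, if $\Gamma \vdash M = N : C$ or $\Gamma \vdash H = H' : \Sigma \Rightarrow C$ is derivable, then $[\![M]\!] = [\![N]\!]$ or $[\![H]\!] = [\![H']\!]$, respectively, in every $\lambda_{\mathrm{eff}}$-model.
   Context: The calculus $\lambda_{\mathrm{eff}}$ (fine-grain call-by-value with deep effect handlers). Value types $A ::= A \to C \mid \prod_{i=1}^n A_i$; computation types $C ::= A\,!\,\Sigma$; a signature $\Sigma$ is a finite set of entries $\mathtt{op} : A \to B$ (operation symbol $\mathtt{op}$ with argument type $A$ and result type $B$; in a signature entry the arrow denotes an operation signature, not a function type); handler types $\Sigma \Rightarrow C$. Values $V ::= x \mid \lambda x.M \mid \langle V_1,\dots,V_n\rangle \mid \pi_i\,V$; computations $M ::= V\,W \mid \mathtt{return}\ V \mid \mathtt{let}\ x \Leftarrow M\ \mathtt{in}\ N \mid \mathtt{op}(V) \mid \mathtt{handle}\ M\ \mathtt{with}\ H\ \mathtt{to}\ x.\,N$; handlers $H ::= \emptyset \mid \{\mathtt{op}(x,k)\mapsto M\}\cup H$. Typing: $\mathtt{return}\ V : A!\Sigma$ if $V : A$; $\mathtt{let}$ sequences two computations with the same $\Sigma$; $\mathtt{op}(V) : B!\Sigma$ if $(\mathtt{op} : A \to B)\in\Sigma$ and $V:A$; $H : \Sigma \Rightarrow C$ has for each $(\mathtt{op}: A_{\mathtt{op}}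 \to B_{\mathtt{op}})\in\Sigma$ a clause $\mathtt{op}(x,k)\mapsto M_{\mathtt{op}}$ with $\Gamma, x:A_{\mathtt{op}}, k:B_{\mathtt{op}}\to C \vdash M_{\mathtt{op}} : C$; $\mathtt{handle}\ M\ \mathtt{with}\ H\ \mathtt{to}\ x.N : C$ if $M : A!\Sigma$, $H : \Sigma\Rightarrow C$, $\Gamma,x:A\vdash N : C$. The equational judgements form the least congruence containing: $\beta/\eta$ for functions and products; the monad laws for $\mathtt{let}$; and (Handle-Ret) $\mathtt{handle}\ \mathtt{return}\ V\ \mathtt{with}\ H\ \mathtt{to}\ x.M = M[V/x]$; (Handle-Let) $\mathtt{handle}\ (\mathtt{let}\ x\Leftarrow L\ \mathtt{in}\ M)\ \mathtt{with}\ H\ \mathtt{to}\ y.N = \mathtt{handle}\ L\ \mathtt{with}\ H\ \mathtt{to}\ x.(\mathtt{handle}\ M\ \mathtt{with}\ H\ \mathtt{to}\ y.N)$; (Handle-Op) $\mathtt{handle}\ \mathtt{op}(V)\ \mathtt{with}\ H\ \mathtt{to}\ x.M = M_{\mathtt{op}}[V/x, \lambda x.M/k]$. Models: let $\mathcal{C}$ be cartesian; for a strong monad $T$ with Kleisli adjunction $J \dashv K$ ($KX = TX$), a Kleisli exponential $(Y \Rightarrow_T Z)$ satisfies $\mathcal{C}_T(J(X\times Y),Z)\cong \mathcal{C}(X, Y\Rightarrow_T Z)$, with currying $\Lambda$ and evaluation $\mathrm{ev} : (Y\Rightarrow_T Z)\times Y \to TZ$. A semantic signature $S$ is a finite partial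 map from operation symbols to pairs of objects. $\mathcal{H}_S(X) = \prod_{(\mathtt{op}:A_{\mathtt{op}}\to B_{\mathtt{op}})\in S}((A_{\mathtt{op}}\times(B_{\mathtt{op}}\Rightarrow_T X))\Rightarrow_T X)$. A $\lambda_{\mathrm{eff}}$-model consists of a cartesian category $\mathcal{C}$, strong monads $T_S$ for each semantic signature $S$ such that $\mathcal{C}$ has Kleisli exponentials for each $T_S$, morphisms $[\![\mathtt{op}]\!]_S : A_{\mathtt{op}} \to T_S B_{\mathtt{op}}$, and morphisms $\mathrm{handle}_{S,S',X} : \mathcal{H}_S(X)\times T_S T_{S'}X \to T_{S'}X$ (with $\mathcal{H}_S(X)$ built from $T_{S'}$) satisfying: $\mathrm{handle}\circ(\mathrm{id}\times\eta^{T_S})=\pi_2$; $\mathrm{handle}\circ(\mathrm{id}\times\mu^{T_S}) = \mathrm{handle}\circ(\mathrm{id}\times T_S\,\mathrm{handle})\circ\langle\pi_1,\mathrm{st}^{T_S}\rangle$; $\mathrm{handle}\circ(\mathrm{id}\times a_{\mathtt{op}}) = \mathrm{ev}\circ(\pi_{\mathtt{op}}\times\mathrm{id})$, where $a_{\mathtt{op}} = T_S\,\mathrm{ev}\circ\mathrm{st}^{T_S}\circ\mathrm{swap}\circ([\![\mathtt{op}]\!]_S\times\mathrm{id}) : A_{\mathtt{op}}\times(B_{\mathtt{op}}\Rightarrow_{T_{S'}}X)\to T_S T_{S'}X$. Interpretation: $[\![A\to B!\Sigma]\!] = [\![A]\!]\Rightarrow_{T_{[\![\Sigma]\!]}}[\![B]\!]$,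 products to products; $[\![V]\!] : [\![\Gamma]\!]\to[\![A]\!]$, $[\![M]\!] : [\![\Gamma]\!]\to T_{[\![\Sigma]\!]}[\![A]\!]$, $[\![H]\!] : [\![\Gamma]\!]\to\mathcal{H}_{[\![\Sigma]\!]}([\![A]\!])$ for $H:\Sigma\Rightarrow A!\Sigma'$; defined as for fine-grain call-by-value (abstraction by $\Lambda$, application by $\mathrm{ev}$, return by $\eta$, let by strong Kleisli extension), with $[\![\mathtt{op}(V)]\!] = [\![\mathtt{op}]\!]\circ[\![V]\!]$, $[\![H]\!]$ the tuple of the curried clauses $\Lambda[\![M_{\mathtt{op}}]\!]$, and $[\![\mathtt{handle}\ M\ \mathtt{with}\ H\ \mathtt{to}\ x.N]\!] = \mathrm{handle}\circ\langle[\![H]\!], T_{[\![\Sigma]\!]}[\![N]\!]\circ\mathrm{st}\circ\langle\mathrm{id},[\![M]\!]\rangle\rangle$. -}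

module Defs where

open import Level using (Level; _⊔_) renaming (suc to lsuc)
open import Data.Nat using (ℕ)
open import Data.List using (List; []; _∷_)
open import Data.Product using (_×_)
open import Relation.Binary.PropositionalEquality using (_≡_)

infix 4 _∋_
data _∋_ {a} {X : Set a} : List X → X → Set a where
  here  : ∀ {x xs} → (x ∷ xs) ∋ x
  there : ∀ {x y xs} → xs ∋ x → (y ∷ xs) ∋ x

infixr 7 _⇒_
infix  8 _!_
infix  9 _∶_⟶_

mutual
  data VTy : Set where
    _⇒_ : VTy → CTy → VTy
    Π   : List VTy → VTy

  data CTy : Set where
    _!_ : VTy → List Entry → CTy

  data Entry : Set where
    _∶_⟶_ : ℕ → VTy → VTy → Entry

Sig : Set
Sig = List Entry

Ctx : Set
Ctx = List VTy   -- the head of the list is the most recently bound variable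

mutual
  data Val (Γ : Ctx) : VTy → Set where
    var   : ∀ {A} → Γ ∋ A → Val Γ A
    lam   : ∀ {A C} → Comp (A ∷ Γ) C → Val Γ (A ⇒ C)
    tuple : ∀ {As} → Vals Γ As → Val Γ (Π As)
    proj  : ∀ {As A} → As ∋ A → Val Γ (Π As) → Val Γ A

  data Vals (Γ : Ctx) : List VTy → Set where
    []  : Vals Γ []
    _∷_ : ∀ {A As} → Val Γ A → Vals Γ As → Vals Γ (A ∷ As)

  data Comp (Γ : Ctx) : CTy → Set where
    app     : ∀ {A C} → Val Γ (A ⇒ C) → Val Γ A → Comp Γ C
    ret     : ∀ {A Σ} → Val Γ A → Comp Γ (A ! Σ)
    letin   : ∀ {A B Σ} → Comp Γ (A ! Σ) → Comp (A ∷ Γ) (B ! Σ) → Comp Γ (B ! Σ)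
    opr     : ∀ {Σ o A B} → Σ ∋ (o ∶ A ⟶ B) → Val Γ A → Comp Γ (B ! Σ)
    handleC : ∀ {A Σ C} → Comp Γ (A ! Σ) → Hdl Γ Σ C → Comp (A ∷ Γ) C → Comp Γ C

  -- H : Σ ⇒ C ; one clause op(x,k) ↦ M for each entry of Σ,
  -- with x : A (second variable) and k : B → C (most recent variable)
  data Hdl (Γ : Ctx) : Sig → CTy → Set where
    ∅     : ∀ {C} → Hdl Γ [] C
    clause : ∀ {o A B Σ C} → Comp ((B ⇒ C) ∷ A ∷ Γ) C → Hdl Γ Σ C
           → Hdl Γ ((o ∶ A ⟶ B) ∷ Σ) C

Ren : Ctx → Ctx → Set
Ren Γ Δ = ∀ {A} → Γ ∋ A → Δ ∋ A

Sub : Ctx → Ctx → Set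
Sub Γ Δ = ∀ {A} → Γ ∋ A → Val Δ A

ext : ∀ {Γ Δ B} → Ren Γ Δ → Ren (B ∷ Γ) (B ∷ Δ)
ext ρ here      = here
ext ρ (there x) = there (ρ x)

mutual
  renV : ∀ {Γ Δ A} → Ren Γ Δ → Val Γ A → Val Δ A
  renV ρ (var x)    = var (ρ x)
  renV ρ (lam M)    = lam (renC (ext ρ) M)
  renV ρ (tuple Vs) = tuple (renVs ρ Vs)
  renV ρ (proj i V) = proj i (renV ρ V)

  renVs : ∀ {Γ Δ As} → Ren Γ Δ → Vals Γ As → Vals Δ As
  renVs ρ []       = []
  renVs ρ (V ∷ Vs) = renV ρ V ∷ renVs ρ Vs

  renC : ∀ {Γ Δ C} → Ren Γ Δ → Comp Γ C → Comp Δ C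
  renC ρ (app V W)       = app (renV ρ V) (renV ρ W)
  renC ρ (ret V)         = ret (renV ρ V)
  renC ρ (letin M N)     = letin (renC ρ M) (renC (ext ρ) N)
  renC ρ (opr p V)       = opr p (renV ρ V)
  renC ρ (handleC M H N) = handleC (renC ρ M) (renH ρ H) (renC (ext ρ) N)

  renH : ∀ {Γ Δ Σ C} → Ren Γ Δ → Hdl Γ Σ C → Hdl Δ Σ C
  renH ρ ∅            = ∅
  renH ρ (clause M H) = clause (renC (ext (ext ρ)) M) (renH ρ H)

exts : ∀ {Γ Δ B} → Sub Γ Δ → Sub (B ∷ Γ) (B ∷ Δ)
exts σ here      = var here
exts σ (there x) = renV there (σ x)

mutual
  subV : ∀ {Γ Δ A} → Sub Γ Δ → Val Γ A → Val Δ A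
  subV σ (var x)    = σ x
  subV σ (lam M)    = lam (subC (exts σ) M)
  subV σ (tuple Vs) = tuple (subVs σ Vs)
  subV σ (proj i V) = proj i (subV σ V)

  subVs : ∀ {Γ Δ As} → Sub Γ Δ → Vals Γ As → Vals Δ As
  subVs σ []       = []
  subVs σ (V ∷ Vs) = subV σ V ∷ subVs σ Vs

  subC : ∀ {Γ Δ C} → Sub Γ Δ → Comp Γ C → Comp Δ C
  subC σ (app V W)       = app (subV σ V) (subV σ W)
  subC σ (ret V)         = ret (subV σ V)
  subC σ (letin M N)     = letin (subC σ M) (subC (exts σ) N)
  subC σ (opr p V)       = opr p (subV σ V)
  subC σ (handleC M H N) = handleC (subC σ M) (subH σ H) (subC (exts σ) N)

  subH : ∀ {Γ Δ Σ C} → Sub Γ Δ → Hdl Γ Σ C → Hdl Δ Σ C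
  subH σ ∅            = ∅
  subH σ (clause M H) = clause (subC (exts (exts σ)) M) (subH σ H)

_[_] : ∀ {Γ A C} → Comp (A ∷ Γ) C → Val Γ A → Comp Γ C
_[_] {Γ} {A} M V = subC σ M
  where
  σ : Sub (A ∷ Γ) Γ
  σ here      = V
  σ (there x) = var x

_[_,_] : ∀ {Γ A B C} → Comp ((B ⇒ C) ∷ A ∷ Γ) C → Val Γ A → Val Γ (B ⇒ C)
       → Comp Γ C
_[_,_] {Γ} {A} {B} {C} M V K = subC σ M
  where
  σ : Sub ((B ⇒ C) ∷ A ∷ Γ) Γ
  σ here              = K
  σ (there here)      = V
  σ (there (there x)) = var x

lookupVs : ∀ {Γ As A} → Vals Γ As → As ∋ A → Val Γ A
lookupVs (V ∷ Vs) here      = V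
lookupVs (V ∷ Vs) (there i) = lookupVs Vs i

tabulateVs : ∀ {Γ} As → (∀ {A} → As ∋ A → Val Γ A) → Vals Γ As
tabulateVs []       f = []
tabulateVs (A ∷ As) f = f here ∷ tabulateVs As (λ i → f (there i))

lookupH : ∀ {Γ Σ C o A B} → Hdl Γ Σ C → Σ ∋ (o ∶ A ⟶ B)
        → Comp ((B ⇒ C) ∷ A ∷ Γ) C
lookupH (clause M H) here      = M
lookupH (clause M H) (there p) = lookupH H p

infix 4 _≈v_ _≈vs_ _≈c_ _≈h_

mutual
  data _≈v_ {Γ : Ctx} : ∀ {A} → Val Γ A → Val Γ A → Set where
    ≈v-refl  : ∀ {A} {V : Val Γ A} → V ≈v V
    ≈v-sym   : ∀ {A} {V W : Val Γ A} → V ≈v W → W ≈v V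
    ≈v-trans : ∀ {A} {U V W : Val Γ A} → U ≈v V → V ≈v W → U ≈v W
    lam-cong   : ∀ {A C} {M N : Comp (A ∷ Γ) C} → M ≈c N → lam M ≈v lam N
    tuple-cong : ∀ {As} {Vs Ws : Vals Γ As} → Vs ≈vs Ws → tuple Vs ≈v tuple Ws
    proj-cong  : ∀ {As A} (i : As ∋ A) {V W : Val Γ (Π As)} → V ≈v W
               → proj i V ≈v proj i W
    fun-η  : ∀ {A C} (V : Val Γ (A ⇒ C)) → lam (app (renV there V) (var here)) ≈v V
    prod-β : ∀ {As A} (Vs : Vals Γ As) (i : As ∋ A) → proj i (tuple Vs) ≈v lookupVs Vs i
    prod-η : ∀ {As} (V : Val Γ (Π As)) → tuple (tabulateVs As (λ i → proj i V)) ≈v V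

  data _≈vs_ {Γ : Ctx} : ∀ {As} → Vals Γ As → Vals Γ As → Set where
    []  : [] ≈vs []
    _∷_ : ∀ {A As} {V W : Val Γ A} {Vs Ws : Vals Γ As}
        → V ≈v W → Vs ≈vs Ws → (V ∷ Vs) ≈vs (W ∷ Ws)

  data _≈c_ {Γ : Ctx} : ∀ {C} → Comp Γ C → Comp Γ C → Set where
    ≈c-refl  : ∀ {C} {M : Comp Γ C} → M ≈c M
    ≈c-sym   : ∀ {C} {M N : Comp Γ C} → M ≈c N → N ≈c M
    ≈c-trans : ∀ {C} {L M N : Comp Γ C} → L ≈c M → M ≈c N → L ≈c N
    app-cong    : ∀ {A C} {V V' : Val Γ (A ⇒ C)} {W W' : Val Γ A}
                → V ≈v V' → W ≈v W' → app V W ≈c app V' W'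
    ret-cong    : ∀ {A Σ} {V W : Val Γ A} → V ≈v W → ret {Σ = Σ} V ≈c ret W
    letin-cong  : ∀ {A B Σ} {M M' : Comp Γ (A ! Σ)} {N N' : Comp (A ∷ Γ) (B ! Σ)}
                → M ≈c M' → N ≈c N' → letin M N ≈c letin M' N'
    opr-cong    : ∀ {Σ o A B} (p : Σ ∋ (o ∶ A ⟶ B)) {V W : Val Γ A}
                → V ≈v W → opr p V ≈c opr p W
    handle-cong : ∀ {A Σ C} {M M' : Comp Γ (A ! Σ)} {H H' : Hdl Γ Σ C}
                  {N N' : Comp (A ∷ Γ) C}
                → M ≈c M' → H ≈h H' → N ≈c N' → handleC M H N ≈c handleC M' H' N'
    fun-β : ∀ {A C} (M : Comp (A ∷ Γ) C) (V : Val Γ A) → app (lam M) V ≈c M [ V ]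
    let-β     : ∀ {A B Σ} (V : Val Γ A) (N : Comp (A ∷ Γ) (B ! Σ))
              → letin (ret V) N ≈c N [ V ]
    let-η     : ∀ {A Σ} (M : Comp Γ (A ! Σ)) → letin M (ret (var here)) ≈c M
    let-assoc : ∀ {A B D Σ} (L : Comp Γ (A ! Σ)) (M : Comp (A ∷ Γ) (B ! Σ))
                (N : Comp (B ∷ Γ) (D ! Σ))
              → letin (letin L M) N ≈c letin L (letin M (renC (ext there) N))
    Handle-Ret : ∀ {A Σ C} (V : Val Γ A) (H : Hdl Γ Σ C) (N : Comp (A ∷ Γ) C)
               → handleC (ret V) H N ≈c N [ V ]
    Handle-Let : ∀ {A B Σ C} (L : Comp Γ (A ! Σ)) (M : Comp (A ∷ Γ) (B ! Σ))
                 (H : Hdl Γ Σ C) (N : Comp (B ∷ Γ) C)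
               → handleC (letin L M) H N
                 ≈c handleC L H (handleC M (renH there H) (renC (ext there) N))
    Handle-Op  : ∀ {Σ o A B C} (p : Σ ∋ (o ∶ A ⟶ B)) (V : Val Γ A)
                 (H : Hdl Γ Σ C) (N : Comp (B ∷ Γ) C)
               → handleC (opr p V) H N ≈c (lookupH H p) [ V , lam N ]

  data _≈h_ {Γ : Ctx} : ∀ {Σ C} → Hdl Γ Σ C → Hdl Γ Σ C → Set where
    ≈h-refl  : ∀ {Σ C} {H : Hdl Γ Σ C} → H ≈h H
    ≈h-sym   : ∀ {Σ C} {H H' : Hdl Γ Σ C} → H ≈h H' → H' ≈h H
    ≈h-trans : ∀ {Σ C} {H H' H'' : Hdl Γ Σ C} → H ≈h H' → H' ≈h H'' → H ≈h H''
    clause-cong : ∀ {o A B Σ C} {M M' : Comp ((B ⇒ C) ∷ A ∷ Γ) C} {H H' : Hdl Γ Σ C}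
                → M ≈c M' → H ≈h H' → clause {o = o} M H ≈h clause M' H'

-- Categorical structure (hom-sets are types, equality of morphisms is ≡)

record Category (o ℓ : Level) : Set (lsuc (o ⊔ ℓ)) where
  infixr 9 _∘_
  field
    Obj : Set o
    Hom : Obj → Obj → Set ℓ
    id  : ∀ {X} → Hom X X
    _∘_ : ∀ {X Y Z} → Hom Y Z → Hom X Y → Hom X Z
    identityˡ : ∀ {X Y} {f : Hom X Y} → id ∘ f ≡ f
    identityʳ : ∀ {X Y} {f : Hom X Y} → f ∘ id ≡ f
    assoc     : ∀ {W X Y Z} {f : Hom W X} {g : Hom X Y} {h : Hom Y Z}
              → (h ∘ g) ∘ f ≡ h ∘ (g ∘ f)

record Cartesian (o ℓ : Level) : Set (lsuc (o ⊔ ℓ)) where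
  field
    category : Category o ℓ
  open Category category
  infixr 7 _⊗₀_
  field
    ⊤        : Obj
    !ₜ       : ∀ {X} → Hom X ⊤
    !-unique : ∀ {X} (f : Hom X ⊤) → f ≡ !ₜ
    _⊗₀_     : Obj → Obj → Obj
    π₁       : ∀ {X Y} → Hom (X ⊗₀ Y) X
    π₂       : ∀ {X Y} → Hom (X ⊗₀ Y) Y
    ⟨_,_⟩    : ∀ {Z X Y} → Hom Z X → Hom Z Y → Hom Z (X ⊗₀ Y)
    π₁-β     : ∀ {Z X Y} {f : Hom Z X} {g : Hom Z Y} → π₁ ∘ ⟨ f , g ⟩ ≡ f
    π₂-β     : ∀ {Z X Y} {f : Hom Z X} {g : Hom Z Y} → π₂ ∘ ⟨ f , g ⟩ ≡ g
    ⟨⟩-η     : ∀ {Z X Y} {h : Hom Z (X ⊗₀ Y)} → ⟨ π₁ ∘ h , π₂ ∘ h ⟩ ≡ h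

  infixr 7 _⊗₁_
  _⊗₁_ : ∀ {X X' Y Y'} → Hom X X' → Hom Y Y' → Hom (X ⊗₀ Y) (X' ⊗₀ Y')
  f ⊗₁ g = ⟨ f ∘ π₁ , g ∘ π₂ ⟩

  swap : ∀ {X Y} → Hom (X ⊗₀ Y) (Y ⊗₀ X)
  swap = ⟨ π₂ , π₁ ⟩

  α : ∀ {X Y Z} → Hom ((X ⊗₀ Y) ⊗₀ Z) (X ⊗₀ (Y ⊗₀ Z))
  α = ⟨ π₁ ∘ π₁ , ⟨ π₂ ∘ π₁ , π₂ ⟩ ⟩

  α⁻¹ : ∀ {X Y Z} → Hom (X ⊗₀ (Y ⊗₀ Z)) ((X ⊗₀ Y) ⊗₀ Z)
  α⁻¹ = ⟨ ⟨ π₁ , π₁ ∘ π₂ ⟩ , π₂ ∘ π₂ ⟩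

module _ {o ℓ : Level} (𝒞 : Cartesian o ℓ) where
  open Cartesian 𝒞
  open Category category

  record StrongMonad : Set (o ⊔ ℓ) where
    field
      T₀   : Obj → Obj
      T₁   : ∀ {X Y} → Hom X Y → Hom (T₀ X) (T₀ Y)
      T-id : ∀ {X} → T₁ (id {X}) ≡ id
      T-∘  : ∀ {X Y Z} {f : Hom X Y} {g : Hom Y Z} → T₁ (g ∘ f) ≡ T₁ g ∘ T₁ f
      η    : ∀ {X} → Hom X (T₀ X)
      μ    : ∀ {X} → Hom (T₀ (T₀ X)) (T₀ X)
      η-natural : ∀ {X Y} {f : Hom X Y} → T₁ f ∘ η ≡ η ∘ f
      μ-natural : ∀ {X Y} {f : Hom X Y} → T₁ f ∘ μ ≡ μ ∘ T₁ (T₁ f)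
      μ-assoc   : ∀ {X} → μ {X} ∘ T₁ μ ≡ μ ∘ μ
      μ-unitˡ   : ∀ {X} → μ {X} ∘ T₁ η ≡ id
      μ-unitʳ   : ∀ {X} → μ {X} ∘ η ≡ id
      st        : ∀ {X Y} → Hom (X ⊗₀ T₀ Y) (T₀ (X ⊗₀ Y))
      st-natural : ∀ {X X' Y Y'} {f : Hom X X'} {g : Hom Y Y'}
                 → T₁ (f ⊗₁ g) ∘ st ≡ st ∘ (f ⊗₁ T₁ g)
      st-unit    : ∀ {Y} → T₁ π₂ ∘ st {⊤} {Y} ≡ π₂
      st-assoc   : ∀ {X Y Z} → T₁ α ∘ st {X ⊗₀ Y} {Z} ≡ st ∘ (id ⊗₁ st) ∘ α
      st-η       : ∀ {X Y} → st {X} {Y} ∘ (id ⊗₁ η) ≡ η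
      st-μ       : ∀ {X Y} → st {X} {Y} ∘ (id ⊗₁ μ) ≡ μ ∘ T₁ st ∘ st

  -- Kleisli exponentials:  C_T(J(X × Y), Z) ≅ C(X, Y ⇒_T Z), via Λ and ev
  record KleisliExponentials (T : StrongMonad) : Set (o ⊔ ℓ) where
    open StrongMonad T
    field
      _⇒T_ : Obj → Obj → Obj
      ev   : ∀ {Y Z} → Hom ((Y ⇒T Z) ⊗₀ Y) (T₀ Z)
      Λ    : ∀ {X Y Z} → Hom (X ⊗₀ Y) (T₀ Z) → Hom X (Y ⇒T Z)
      Λ-β  : ∀ {X Y Z} {f : Hom (X ⊗₀ Y) (T₀ Z)} → ev ∘ (Λ f ⊗₁ id) ≡ f
      Λ-η  : ∀ {X Y Z} {g : Hom X (Y ⇒T Z)} → Λ (ev ∘ (g ⊗₁ id)) ≡ g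

record SemEntry {o} (Obj : Set o) : Set o where
  constructor _∶_⟶ₛ_
  field
    name : ℕ
    dom  : Obj
    cod  : Obj

record PreModel (o ℓ : Level) : Set (lsuc (o ⊔ ℓ)) where
  field
    cartesian : Cartesian o ℓ
  open Cartesian cartesian public
  open Category category public

  SemSig : Set o
  SemSig = List (SemEntry Obj)

  field
    T     : SemSig → StrongMonad cartesian
    exps  : (S : SemSig) → KleisliExponentials cartesian (T S)
    ⟦op⟧  : (S : SemSig) {o : ℕ} {A B : Obj} → S ∋ (o ∶ A ⟶ₛ B)
          → Hom A (StrongMonad.T₀ (T S) B)

  T₀ : SemSig → Obj → Obj
  T₀ S = StrongMonad.T₀ (T S)

  _⇒[_]_ : Obj → SemSig → Obj → Obj
  Y ⇒[ S ] Z = KleisliExponentials._⇒T_ (exps S) Y Z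

  ℋ : (S S' : SemSig) → Obj → Obj
  ℋ []                   S' X = ⊤
  ℋ ((o ∶ A ⟶ₛ B) ∷ S) S' X = ((A ⊗₀ (B ⇒[ S' ] X)) ⇒[ S' ] X) ⊗₀ ℋ S S' X

  πℋ : ∀ {S S' X o A B} → S ∋ (o ∶ A ⟶ₛ B)
     → Hom (ℋ S S' X) ((A ⊗₀ (B ⇒[ S' ] X)) ⇒[ S' ] X)
  πℋ here      = π₁
  πℋ (there p) = πℋ p ∘ π₂

  a-op : ∀ {S S' X o A B} → S ∋ (o ∶ A ⟶ₛ B)
       → Hom (A ⊗₀ (B ⇒[ S' ] X)) (T₀ S (T₀ S' X))
  a-op {S} {S'} p =
    StrongMonad.T₁ (T S) (KleisliExponentials.ev (exps S'))
      ∘ StrongMonad.st (T S) ∘ swap ∘ (⟦op⟧ S p ⊗₁ id)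

record Model (o ℓ : Level) : Set (lsuc (o ⊔ ℓ)) where
  field
    preModel : PreModel o ℓ
  open PreModel preModel public
  field
    handle : (S S' : SemSig) (X : Obj)
           → Hom (ℋ S S' X ⊗₀ T₀ S (T₀ S' X)) (T₀ S' X)
    handle-η  : ∀ {S S' X}
              → handle S S' X ∘ (id ⊗₁ StrongMonad.η (T S)) ≡ π₂
    handle-μ  : ∀ {S S' X}
              → handle S S' X ∘ (id ⊗₁ StrongMonad.μ (T S))
                ≡ handle S S' X ∘ (id ⊗₁ StrongMonad.T₁ (T S) (handle S S' X))
                    ∘ ⟨ π₁ , StrongMonad.st (T S) ⟩
    handle-op : ∀ {S S' X o A B} (p : S ∋ (o ∶ A ⟶ₛ B))
              → handle S S' X ∘ (id ⊗₁ a-op {S} {S'} {X} p)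
                ≡ KleisliExponentials.ev (exps S') ∘ (πℋ p ⊗₁ id)

module Interp {o ℓ : Level} (𝓜 : Model o ℓ) where
  open Model 𝓜

  private
    module TM (S : SemSig) = StrongMonad (T S)
    module EX (S : SemSig) = KleisliExponentials (exps S)

  mutual
    ⟦_⟧ty : VTy → Obj
    ⟦ A ⇒ (B ! Σ) ⟧ty = ⟦ A ⟧ty ⇒[ ⟦ Σ ⟧sig ] ⟦ B ⟧ty
    ⟦ Π As ⟧ty        = ⟦ As ⟧tys

    ⟦_⟧tys : List VTy → Obj
    ⟦ [] ⟧tys     = ⊤
    ⟦ A ∷ As ⟧tys = ⟦ A ⟧ty ⊗₀ ⟦ As ⟧tys

    ⟦_⟧sig : Sig → SemSig
    ⟦ [] ⟧sig                = []
    ⟦ (o ∶ A ⟶ B) ∷ Σ ⟧sig = (o ∶ ⟦ A ⟧ty ⟶ₛ ⟦ B ⟧ty) ∷ ⟦ Σ ⟧sig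

  ⟦_⟧cty : CTy → Obj
  ⟦ A ! Σ ⟧cty = T₀ ⟦ Σ ⟧sig ⟦ A ⟧ty

  ⟦_⟧ctx : Ctx → Obj
  ⟦ [] ⟧ctx    = ⊤
  ⟦ A ∷ Γ ⟧ctx = ⟦ Γ ⟧ctx ⊗₀ ⟦ A ⟧ty

  ⟦_⟧var : ∀ {Γ A} → Γ ∋ A → Hom ⟦ Γ ⟧ctx ⟦ A ⟧ty
  ⟦ here ⟧var    = π₂
  ⟦ there x ⟧var = ⟦ x ⟧var ∘ π₁

  ⟦_⟧proj : ∀ {As A} → As ∋ A → Hom ⟦ As ⟧tys ⟦ A ⟧ty
  ⟦ here ⟧proj    = π₁
  ⟦ there i ⟧proj = ⟦ i ⟧proj ∘ π₂

  ⟦_⟧∋ : ∀ {Σ o A B} → Σ ∋ (o ∶ A ⟶ B) → ⟦ Σ ⟧sig ∋ (o ∶ ⟦ A ⟧ty ⟶ₛ ⟦ B ⟧ty)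
  ⟦ here ⟧∋    = here
  ⟦ there {y = _ ∶ _ ⟶ _} p ⟧∋ = there ⟦ p ⟧∋

  -- strong Kleisli extension  f† ∘ ⟨id, g⟩
  private
    bind : ∀ {S X A B} → Hom X (T₀ S A) → Hom (X ⊗₀ A) (T₀ S B) → Hom X (T₀ S B)
    bind {S} g f = TM.μ S ∘ TM.T₁ S f ∘ TM.st S ∘ ⟨ id , g ⟩

  mutual
    ⟦_⟧v : ∀ {Γ A} → Val Γ A → Hom ⟦ Γ ⟧ctx ⟦ A ⟧ty
    ⟦ var x ⟧v                      = ⟦ x ⟧var
    ⟦ lam {C = B ! Σ} M ⟧v          = EX.Λ ⟦ Σ ⟧sig ⟦ M ⟧c
    ⟦ tuple Vs ⟧v                   = ⟦ Vs ⟧vs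
    ⟦ proj i V ⟧v                   = ⟦ i ⟧proj ∘ ⟦ V ⟧v

    ⟦_⟧vs : ∀ {Γ As} → Vals Γ As → Hom ⟦ Γ ⟧ctx ⟦ As ⟧tys
    ⟦ [] ⟧vs     = !ₜ
    ⟦ V ∷ Vs ⟧vs = ⟨ ⟦ V ⟧v , ⟦ Vs ⟧vs ⟩

    ⟦_⟧c : ∀ {Γ C} → Comp Γ C → Hom ⟦ Γ ⟧ctx ⟦ C ⟧cty
    ⟦ app {C = B ! Σ} V W ⟧c = EX.ev ⟦ Σ ⟧sig ∘ ⟨ ⟦ V ⟧v , ⟦ W ⟧v ⟩
    ⟦ ret {Σ = Σ} V ⟧c       = TM.η ⟦ Σ ⟧sig ∘ ⟦ V ⟧v
    ⟦ letin {Σ = Σ} M N ⟧c   = bind {S = ⟦ Σ ⟧sig} ⟦ M ⟧c ⟦ N ⟧c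
    ⟦ opr {Σ = Σ} p V ⟧c     = ⟦op⟧ ⟦ Σ ⟧sig ⟦ p ⟧∋ ∘ ⟦ V ⟧v
    ⟦ handleC {A = A} {Σ = Σ} {C = B ! Σ'} M H N ⟧c =
      handle ⟦ Σ ⟧sig ⟦ Σ' ⟧sig ⟦ B ⟧ty
        ∘ ⟨ ⟦ H ⟧h , TM.T₁ ⟦ Σ ⟧sig ⟦ N ⟧c ∘ TM.st ⟦ Σ ⟧sig ∘ ⟨ id , ⟦ M ⟧c ⟩ ⟩

    ⟦_⟧h : ∀ {Γ Σ A Σ'} → Hdl Γ Σ (A ! Σ')
         → Hom ⟦ Γ ⟧ctx (ℋ ⟦ Σ ⟧sig ⟦ Σ' ⟧sig ⟦ A ⟧ty)
    ⟦ ∅ ⟧h                       = !ₜ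
    ⟦ clause {C = A ! Σ'} M H ⟧h = ⟨ EX.Λ ⟦ Σ' ⟧sig (⟦ M ⟧c ∘ α⁻¹) , ⟦ H ⟧h ⟩

-- Every term former is interpreted naturally in the context, which yields the
-- substitution lemma ⟦ M [ σ ] ⟧ = ⟦ M ⟧ ∘ ⟦ σ ⟧. Given it, β and η for functions are the two
-- laws of the Kleisli exponential, the monad laws for let are the laws of the strong Kleisli
-- extension, and Handle-Ret, Handle-Let, Handle-Op are the three axioms handle-η, handle-μ,
-- handle-op of a model: for Handle-Let the strength carries the handler into the continuation,
-- and for Handle-Op a handled operation call is a-op applied to its argument and to the curried
-- continuation.
{-# OPTIONS --safe #-}
module Submission where

open import Defs
open import Level using (Level)
open import Data.List using (List; []; _∷_)
open import Data.Product using (_×_)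
open import Relation.Binary.PropositionalEquality
  using (_≡_; refl; sym; trans; cong; cong₂; module ≡-Reasoning)

module CartesianProperties {o ℓ : Level} (𝒞 : Cartesian o ℓ) where
  open Cartesian 𝒞
  open Category category
  open ≡-Reasoning

  private variable
    V W X X' X'' Y Y' Y'' Z : Obj

  infixr 4 refl⟩∘⟨_

  refl⟩∘⟨_ : {f : Hom Y Z} {g h : Hom X Y} → g ≡ h → f ∘ g ≡ f ∘ h
  refl⟩∘⟨_ = cong (_ ∘_)

  pullˡ : {f : Hom Y Z} {g : Hom X Y} {h : Hom X Z} {k : Hom W X}
        → f ∘ g ≡ h → f ∘ (g ∘ k) ≡ h ∘ k
  pullˡ e = trans (sym assoc) (cong (_∘ _) e)

  pullʳ : {f : Hom Y Z} {g : Hom X Y} {k : Hom W X} {h : Hom W Y}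
        → g ∘ k ≡ h → (f ∘ g) ∘ k ≡ f ∘ h
  pullʳ e = trans assoc (refl⟩∘⟨ e)

  pushʳ : {f : Hom Y Z} {g : Hom W Y} {h : Hom X Y} {k : Hom W X}
        → g ≡ h ∘ k → f ∘ g ≡ (f ∘ h) ∘ k
  pushʳ e = trans (refl⟩∘⟨ e) (sym assoc)

  ⟨⟩∘ : {f : Hom Y X} {g : Hom Y Z} {h : Hom W Y} → ⟨ f , g ⟩ ∘ h ≡ ⟨ f ∘ h , g ∘ h ⟩
  ⟨⟩∘ {f = f} {g} {h} = begin
    ⟨ f , g ⟩ ∘ h                                   ≡⟨ ⟨⟩-η ⟨
    ⟨ π₁ ∘ (⟨ f , g ⟩ ∘ h) , π₂ ∘ (⟨ f , g ⟩ ∘ h) ⟩ ≡⟨ cong₂ ⟨_,_⟩ (pullˡ π₁-β) (pullˡ π₂-β) ⟩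
    ⟨ f ∘ h , g ∘ h ⟩                               ∎

  ⟨π₁,π₂⟩≡id : ⟨ π₁ , π₂ ⟩ ≡ id {X ⊗₀ Y}
  ⟨π₁,π₂⟩≡id = trans (cong₂ ⟨_,_⟩ (sym identityʳ) (sym identityʳ)) ⟨⟩-η

  ⊗₁∘⟨⟩ : {f : Hom X X'} {g : Hom Y Y'} {a : Hom W X} {b : Hom W Y}
        → (f ⊗₁ g) ∘ ⟨ a , b ⟩ ≡ ⟨ f ∘ a , g ∘ b ⟩
  ⊗₁∘⟨⟩ = trans ⟨⟩∘ (cong₂ ⟨_,_⟩ (pullʳ π₁-β) (pullʳ π₂-β))

  first∘⟨⟩ : {f : Hom X X'} {a : Hom W X} {b : Hom W Y}
           → (f ⊗₁ id) ∘ ⟨ a , b ⟩ ≡ ⟨ f ∘ a , b ⟩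
  first∘⟨⟩ = trans ⊗₁∘⟨⟩ (cong ⟨ _ ,_⟩ identityˡ)

  second∘⟨⟩ : {g : Hom Y Y'} {a : Hom W X} {b : Hom W Y}
            → (id ⊗₁ g) ∘ ⟨ a , b ⟩ ≡ ⟨ a , g ∘ b ⟩
  second∘⟨⟩ = trans ⊗₁∘⟨⟩ (cong ⟨_, _ ⟩ identityˡ)

  π₂∘first : {f : Hom X X'} → π₂ ∘ (f ⊗₁ id {Y}) ≡ π₂
  π₂∘first = trans π₂-β identityˡ

  ⊗₁∘⊗₁ : {f : Hom X' X''} {g : Hom Y' Y''} {h : Hom X X'} {k : Hom Y Y'}
        → (f ⊗₁ g) ∘ (h ⊗₁ k) ≡ (f ∘ h) ⊗₁ (g ∘ k)
  ⊗₁∘⊗₁ = trans ⊗₁∘⟨⟩ (cong₂ ⟨_,_⟩ (sym assoc) (sym assoc))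

  swap∘⟨⟩ : {a : Hom W X} {b : Hom W Y} → swap ∘ ⟨ a , b ⟩ ≡ ⟨ b , a ⟩
  swap∘⟨⟩ = trans ⟨⟩∘ (cong₂ ⟨_,_⟩ π₂-β π₁-β)

  α∘⟨⟩ : {a : Hom V X} {b : Hom V Y} {c : Hom V Z}
       → α ∘ ⟨ ⟨ a , b ⟩ , c ⟩ ≡ ⟨ a , ⟨ b , c ⟩ ⟩
  α∘⟨⟩ = trans ⟨⟩∘ (cong₂ ⟨_,_⟩ (trans (pullʳ π₁-β) π₁-β)
                                (trans ⟨⟩∘ (cong₂ ⟨_,_⟩ (trans (pullʳ π₁-β) π₂-β) π₂-β)))

  α⁻¹∘⟨⟩ : {a : Hom V X} {b : Hom V Y} {c : Hom V Z}
         → α⁻¹ ∘ ⟨ a , ⟨ b , c ⟩ ⟩ ≡ ⟨ ⟨ a , b ⟩ , c ⟩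
  α⁻¹∘⟨⟩ = trans ⟨⟩∘ (cong₂ ⟨_,_⟩ (trans ⟨⟩∘ (cong₂ ⟨_,_⟩ π₁-β (trans (pullʳ π₂-β) π₁-β)))
                                  (trans (pullʳ π₂-β) π₂-β))

  α⁻¹-natural : {f : Hom X X'} → α⁻¹ ∘ (f ⊗₁ id {Y ⊗₀ Z}) ≡ ((f ⊗₁ id) ⊗₁ id) ∘ α⁻¹
  α⁻¹-natural {f = f} = begin
    α⁻¹ ∘ ⟨ f ∘ π₁ , id ∘ π₂ ⟩
      ≡⟨ refl⟩∘⟨ cong₂ ⟨_,_⟩ refl (trans identityˡ (sym ⟨⟩-η)) ⟩
    α⁻¹ ∘ ⟨ f ∘ π₁ , ⟨ π₁ ∘ π₂ , π₂ ∘ π₂ ⟩ ⟩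
      ≡⟨ α⁻¹∘⟨⟩ ⟩
    ⟨ ⟨ f ∘ π₁ , π₁ ∘ π₂ ⟩ , π₂ ∘ π₂ ⟩
      ≡⟨ trans ⊗₁∘⟨⟩ (cong₂ ⟨_,_⟩ first∘⟨⟩ identityˡ) ⟨
    ((f ⊗₁ id) ⊗₁ id) ∘ α⁻¹
      ∎

  module StrongMonadProperties (𝕋 : StrongMonad 𝒞) where
    open StrongMonad 𝕋 public

    T₁∘T₁ : {f : Hom X Y} {g : Hom Y Z} {k : Hom W (T₀ X)} → T₁ g ∘ (T₁ f ∘ k) ≡ T₁ (g ∘ f) ∘ k
    T₁∘T₁ = pullˡ (sym T-∘)

    st-naturalˡ : {f : Hom X X'} → st {X'} {Y} ∘ (f ⊗₁ id) ≡ T₁ (f ⊗₁ id) ∘ st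
    st-naturalˡ {f = f} = sym (trans st-natural (cong (λ g → st ∘ (f ⊗₁ g)) T-id))

    T₁π₂∘st : T₁ π₂ ∘ st {X} {Y} ≡ π₂
    T₁π₂∘st = begin
      T₁ π₂ ∘ st                  ≡⟨ cong (λ p → T₁ p ∘ st) π₂∘first ⟨
      T₁ (π₂ ∘ (!ₜ ⊗₁ id)) ∘ st   ≡⟨ trans (cong (_∘ st) T-∘) assoc ⟩
      T₁ π₂ ∘ T₁ (!ₜ ⊗₁ id) ∘ st  ≡⟨ refl⟩∘⟨ st-naturalˡ ⟨
      T₁ π₂ ∘ st ∘ (!ₜ ⊗₁ id)     ≡⟨ pullˡ st-unit ⟩
      π₂ ∘ (!ₜ ⊗₁ id)             ≡⟨ π₂∘first ⟩
      π₂                          ∎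

    -- map g f and bind g f interpret  let x ⇐ g in return f(γ, x)  and  let x ⇐ g in f(γ, x)
    map : Hom X (T₀ Y) → Hom (X ⊗₀ Y) Z → Hom X (T₀ Z)
    map g f = T₁ f ∘ st ∘ ⟨ id , g ⟩

    bind : Hom X (T₀ Y) → Hom (X ⊗₀ Y) (T₀ Z) → Hom X (T₀ Z)
    bind g f = μ ∘ map g f

    map-⊗₁ : {g : Hom W (T₀ Y)} {f : Hom (X ⊗₀ Y) Z} {k : Hom W X}
           → map g (f ∘ (k ⊗₁ id)) ≡ T₁ f ∘ st ∘ ⟨ k , g ⟩
    map-⊗₁ {g = g} {f} {k} = begin
      T₁ (f ∘ (k ⊗₁ id)) ∘ st ∘ ⟨ id , g ⟩   ≡⟨ T₁∘T₁ ⟨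
      T₁ f ∘ T₁ (k ⊗₁ id) ∘ st ∘ ⟨ id , g ⟩  ≡⟨ refl⟩∘⟨ trans (pullˡ st-naturalˡ) assoc ⟨
      T₁ f ∘ st ∘ (k ⊗₁ id) ∘ ⟨ id , g ⟩     ≡⟨ refl⟩∘⟨ refl⟩∘⟨ first∘⟨⟩ ⟩
      T₁ f ∘ st ∘ ⟨ k ∘ id , g ⟩             ≡⟨ refl⟩∘⟨ refl⟩∘⟨ cong₂ ⟨_,_⟩ identityʳ refl ⟩
      T₁ f ∘ st ∘ ⟨ k , g ⟩                  ∎

    map-natural : {g : Hom X (T₀ Y)} {f : Hom (X ⊗₀ Y) Z} {k : Hom W X}
                → map g f ∘ k ≡ map (g ∘ k) (f ∘ (k ⊗₁ id))
    map-natural {g = g} {f} {k} = begin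
      (T₁ f ∘ st ∘ ⟨ id , g ⟩) ∘ k    ≡⟨ pullʳ (pullʳ ⟨⟩∘) ⟩
      T₁ f ∘ st ∘ ⟨ id ∘ k , g ∘ k ⟩  ≡⟨ refl⟩∘⟨ refl⟩∘⟨ cong₂ ⟨_,_⟩ identityˡ refl ⟩
      T₁ f ∘ st ∘ ⟨ k , g ∘ k ⟩       ≡⟨ map-⊗₁ ⟨
      map (g ∘ k) (f ∘ (k ⊗₁ id))     ∎

    T₁∘map : {g : Hom X (T₀ Y)} {f : Hom (X ⊗₀ Y) Z} {f' : Hom Z W}
           → T₁ f' ∘ map g f ≡ map g (f' ∘ f)
    T₁∘map = T₁∘T₁

    map-η : {v : Hom X Y} {f : Hom (X ⊗₀ Y) Z} → map (η ∘ v) f ≡ η ∘ f ∘ ⟨ id , v ⟩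
    map-η {v = v} {f} = begin
      T₁ f ∘ st ∘ ⟨ id , η ∘ v ⟩          ≡⟨ refl⟩∘⟨ refl⟩∘⟨ second∘⟨⟩ ⟨
      T₁ f ∘ st ∘ (id ⊗₁ η) ∘ ⟨ id , v ⟩  ≡⟨ refl⟩∘⟨ pullˡ st-η ⟩
      T₁ f ∘ η ∘ ⟨ id , v ⟩               ≡⟨ trans (pullˡ η-natural) assoc ⟩
      η ∘ f ∘ ⟨ id , v ⟩                  ∎

    st∘⟨id,st⟩ : {g : Hom X (T₀ Y)} → st ∘ ⟨ id , st ∘ ⟨ id , g ⟩ ⟩ ≡ map g ⟨ π₁ , id ⟩
    st∘⟨id,st⟩ {g = g} = begin
      st ∘ ⟨ id , st ∘ ⟨ id , g ⟩ ⟩               ≡⟨ refl⟩∘⟨ trans (refl⟩∘⟨ α∘⟨⟩) second∘⟨⟩ ⟨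
      st ∘ (id ⊗₁ st) ∘ α ∘ ⟨ ⟨ id , id ⟩ , g ⟩   ≡⟨ trans (refl⟩∘⟨ sym assoc) (sym assoc) ⟩
      (st ∘ (id ⊗₁ st) ∘ α) ∘ ⟨ ⟨ id , id ⟩ , g ⟩ ≡⟨ cong (_∘ _) st-assoc ⟨
      (T₁ α ∘ st) ∘ ⟨ ⟨ id , id ⟩ , g ⟩           ≡⟨ assoc ⟩
      T₁ α ∘ st ∘ ⟨ ⟨ id , id ⟩ , g ⟩             ≡⟨ map-⊗₁ ⟨
      map g (α ∘ (⟨ id , id ⟩ ⊗₁ id))             ≡⟨ cong (map g) α∘⟨id,id⟩⊗₁id ⟩
      map g ⟨ π₁ , id ⟩                           ∎
      where
      α∘⟨id,id⟩⊗₁id : α ∘ (⟨ id , id ⟩ ⊗₁ id) ≡ ⟨ π₁ {X} {Y} , id ⟩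
      α∘⟨id,id⟩⊗₁id = begin
        α ∘ ⟨ ⟨ id , id ⟩ ∘ π₁ , id ∘ π₂ ⟩       ≡⟨ refl⟩∘⟨ cong₂ ⟨_,_⟩ ⟨⟩∘ refl ⟩
        α ∘ ⟨ ⟨ id ∘ π₁ , id ∘ π₁ ⟩ , id ∘ π₂ ⟩  ≡⟨ α∘⟨⟩ ⟩
        ⟨ id ∘ π₁ , ⟨ id ∘ π₁ , id ∘ π₂ ⟩ ⟩
          ≡⟨ cong₂ ⟨_,_⟩ identityˡ (trans (cong₂ ⟨_,_⟩ identityˡ identityˡ) ⟨π₁,π₂⟩≡id) ⟩
        ⟨ π₁ , id ⟩                              ∎

    st∘⟨-,map⟩ : {k : Hom X W} {g : Hom X (T₀ Y)} {f : Hom (X ⊗₀ Y) Z}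
               → st ∘ ⟨ k , map g f ⟩ ≡ map g ⟨ k ∘ π₁ , f ⟩
    st∘⟨-,map⟩ {k = k} {g} {f} = begin
      st ∘ ⟨ k , T₁ f ∘ st ∘ ⟨ id , g ⟩ ⟩          ≡⟨ refl⟩∘⟨ trans ⊗₁∘⟨⟩ (cong₂ ⟨_,_⟩ identityʳ refl) ⟨
      st ∘ (k ⊗₁ T₁ f) ∘ ⟨ id , st ∘ ⟨ id , g ⟩ ⟩  ≡⟨ trans (pullˡ (sym st-natural)) assoc ⟩
      T₁ (k ⊗₁ f) ∘ st ∘ ⟨ id , st ∘ ⟨ id , g ⟩ ⟩  ≡⟨ refl⟩∘⟨ st∘⟨id,st⟩ ⟩
      T₁ (k ⊗₁ f) ∘ map g ⟨ π₁ , id ⟩              ≡⟨ T₁∘map ⟩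
      map g ((k ⊗₁ f) ∘ ⟨ π₁ , id ⟩)               ≡⟨ cong (map g) ⊗₁∘⟨⟩ ⟩
      map g ⟨ k ∘ π₁ , f ∘ id ⟩                    ≡⟨ cong (map g) (cong₂ ⟨_,_⟩ refl identityʳ) ⟩
      map g ⟨ k ∘ π₁ , f ⟩                         ∎

    st∘⟨-,μ⟩ : {k : Hom X W} {t : Hom X (T₀ (T₀ Y))}
             → st ∘ ⟨ k , μ ∘ t ⟩ ≡ μ ∘ T₁ st ∘ st ∘ ⟨ k , t ⟩
    st∘⟨-,μ⟩ = trans (refl⟩∘⟨ sym second∘⟨⟩) (trans (pullˡ st-μ) (trans assoc (refl⟩∘⟨ assoc)))

    bind-η : {g : Hom X (T₀ Y)} {f : Hom (X ⊗₀ Y) Z} → bind g (η ∘ f) ≡ map g f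
    bind-η = trans (refl⟩∘⟨ sym T₁∘T₁) (trans (pullˡ μ-unitˡ) identityˡ)

    bind-identityˡ : {v : Hom X Y} {f : Hom (X ⊗₀ Y) (T₀ Z)} → bind (η ∘ v) f ≡ f ∘ ⟨ id , v ⟩
    bind-identityˡ = trans (refl⟩∘⟨ map-η) (trans (pullˡ μ-unitʳ) identityˡ)

    bind-identityʳ : {g : Hom X (T₀ Y)} → bind g (η ∘ π₂) ≡ g
    bind-identityʳ = trans bind-η (trans (pullˡ T₁π₂∘st) π₂-β)

    bind-natural : {g : Hom X (T₀ Y)} {f : Hom (X ⊗₀ Y) (T₀ Z)} {k : Hom W X}
                 → bind g f ∘ k ≡ bind (g ∘ k) (f ∘ (k ⊗₁ id))
    bind-natural = pullʳ map-natural

    bind-assoc : {l : Hom X (T₀ Y)} {m : Hom (X ⊗₀ Y) (T₀ Z)} {n : Hom (X ⊗₀ Z) (T₀ W)}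
               → bind (bind l m) n ≡ bind l (bind m (n ∘ (π₁ ⊗₁ id)))
    bind-assoc {l = l} {m} {n} = begin
      μ ∘ T₁ n ∘ st ∘ ⟨ id , μ ∘ map l m ⟩
        ≡⟨ refl⟩∘⟨ refl⟩∘⟨ st∘⟨-,μ⟩ ⟩
      μ ∘ T₁ n ∘ μ ∘ T₁ st ∘ st ∘ ⟨ id , map l m ⟩
        ≡⟨ refl⟩∘⟨ refl⟩∘⟨ refl⟩∘⟨ refl⟩∘⟨ st∘⟨-,map⟩ ⟩
      μ ∘ T₁ n ∘ μ ∘ T₁ st ∘ map l ⟨ id ∘ π₁ , m ⟩
        ≡⟨ refl⟩∘⟨ refl⟩∘⟨ refl⟩∘⟨ T₁∘map ⟩
      μ ∘ T₁ n ∘ μ ∘ map l (st ∘ ⟨ id ∘ π₁ , m ⟩)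
        ≡⟨ refl⟩∘⟨ trans (pullˡ μ-natural) assoc ⟩
      μ ∘ μ ∘ T₁ (T₁ n) ∘ map l (st ∘ ⟨ id ∘ π₁ , m ⟩)
        ≡⟨ trans (pullˡ (sym μ-assoc)) assoc ⟩
      μ ∘ T₁ μ ∘ T₁ (T₁ n) ∘ map l (st ∘ ⟨ id ∘ π₁ , m ⟩)
        ≡⟨ refl⟩∘⟨ trans (refl⟩∘⟨ T₁∘map) T₁∘map ⟩
      μ ∘ map l (μ ∘ T₁ n ∘ st ∘ ⟨ id ∘ π₁ , m ⟩)
        ≡⟨ cong (λ p → μ ∘ map l (μ ∘ T₁ n ∘ st ∘ ⟨ p , m ⟩)) identityˡ ⟩
      μ ∘ map l (μ ∘ T₁ n ∘ st ∘ ⟨ π₁ , m ⟩)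
        ≡⟨ cong (λ p → μ ∘ map l (μ ∘ p)) map-⊗₁ ⟨
      bind l (bind m (n ∘ (π₁ ⊗₁ id)))
        ∎

    map-bind : {l : Hom X (T₀ Y)} {m : Hom (X ⊗₀ Y) (T₀ Z)} {n : Hom (X ⊗₀ Z) W}
             → map (bind l m) n ≡ bind l (map m (n ∘ (π₁ ⊗₁ id)))
    map-bind {l = l} {m} {n} = begin
      map (bind l m) n                        ≡⟨ bind-η ⟨
      bind (bind l m) (η ∘ n)                 ≡⟨ bind-assoc ⟩
      bind l (bind m ((η ∘ n) ∘ (π₁ ⊗₁ id)))  ≡⟨ cong (λ p → bind l (bind m p)) assoc ⟩
      bind l (bind m (η ∘ n ∘ (π₁ ⊗₁ id)))    ≡⟨ cong (bind l) bind-η ⟩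
      bind l (map m (n ∘ (π₁ ⊗₁ id)))         ∎

  module KleisliExponentialProperties {𝕋 : StrongMonad 𝒞} (E : KleisliExponentials 𝒞 𝕋) where
    open StrongMonad 𝕋 using (T₀)
    open KleisliExponentials E public

    Λ-natural : {f : Hom (X ⊗₀ Y) (T₀ Z)} {g : Hom W X} → Λ f ∘ g ≡ Λ (f ∘ (g ⊗₁ id))
    Λ-natural {f = f} {g} = begin
      Λ f ∘ g                           ≡⟨ Λ-η ⟨
      Λ (ev ∘ ((Λ f ∘ g) ⊗₁ id))        ≡⟨ cong (λ p → Λ (ev ∘ ((Λ f ∘ g) ⊗₁ p))) identityˡ ⟨
      Λ (ev ∘ ((Λ f ∘ g) ⊗₁ (id ∘ id))) ≡⟨ cong (λ p → Λ (ev ∘ p)) ⊗₁∘⊗₁ ⟨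
      Λ (ev ∘ (Λ f ⊗₁ id) ∘ (g ⊗₁ id))  ≡⟨ cong Λ (pullˡ Λ-β) ⟩
      Λ (f ∘ (g ⊗₁ id))                 ∎

    Λ-η′ : {g : Hom X (Y ⇒T Z)} → Λ (ev ∘ ⟨ g ∘ π₁ , π₂ ⟩) ≡ g
    Λ-η′ = trans (cong (λ p → Λ (ev ∘ ⟨ _ , p ⟩)) (sym identityˡ)) Λ-η

    ev∘⟨Λ,-⟩ : {f : Hom (X ⊗₀ Y) (T₀ Z)} {g : Hom X Y} → ev ∘ ⟨ Λ f , g ⟩ ≡ f ∘ ⟨ id , g ⟩
    ev∘⟨Λ,-⟩ = trans (refl⟩∘⟨ trans (cong ⟨_, _ ⟩ (sym identityʳ)) (sym first∘⟨⟩)) (pullˡ Λ-β)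

    -- curries the two bound variables x and k of a handler clause at once, as in ⟦ clause M H ⟧h
    Λ₂ : Hom ((X ⊗₀ Y) ⊗₀ Z) (T₀ W) → Hom X ((Y ⊗₀ Z) ⇒T W)
    Λ₂ m = Λ (m ∘ α⁻¹)

    Λ₂-natural : {m : Hom ((X ⊗₀ Y) ⊗₀ Z) (T₀ W)} {k : Hom V X}
               → Λ₂ m ∘ k ≡ Λ₂ (m ∘ ((k ⊗₁ id) ⊗₁ id))
    Λ₂-natural = trans Λ-natural (cong Λ (trans assoc (trans (refl⟩∘⟨ α⁻¹-natural) (sym assoc))))

    ev∘⟨Λ₂,-⟩ : {m : Hom ((X ⊗₀ Y) ⊗₀ Z) (T₀ W)} {a : Hom X Y} {b : Hom X Z}
              → ev ∘ ⟨ Λ₂ m , ⟨ a , b ⟩ ⟩ ≡ m ∘ ⟨ ⟨ id , a ⟩ , b ⟩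
    ev∘⟨Λ₂,-⟩ = trans ev∘⟨Λ,-⟩ (pullʳ α⁻¹∘⟨⟩)

module ModelProperties {o ℓ : Level} (𝓜 : Model o ℓ) where
  open Model 𝓜
  open CartesianProperties cartesian public
  open ≡-Reasoning

  module Monad (S : SemSig) = StrongMonadProperties (T S)
  module Exponential (S : SemSig) = KleisliExponentialProperties (exps S)

  private variable
    S S' : SemSig
    W X Y A B : Obj

  -- ⟦ handleC M H N ⟧c and ⟦ letin M N ⟧c unfold to handleWith ⟦ H ⟧h ⟦ M ⟧c ⟦ N ⟧c
  -- and Monad.bind _ ⟦ M ⟧c ⟦ N ⟧c
  handleWith : Hom Y (ℋ S S' X) → Hom Y (T₀ S A) → Hom (Y ⊗₀ A) (T₀ S' X) → Hom Y (T₀ S' X)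
  handleWith {S = S} {S'} {X} h m n = handle S S' X ∘ ⟨ h , Monad.map S m n ⟩

  handleWith-cong : {h h' : Hom Y (ℋ S S' X)} {m m' : Hom Y (T₀ S A)}
                    {n n' : Hom (Y ⊗₀ A) (T₀ S' X)}
                  → h ≡ h' → m ≡ m' → n ≡ n' → handleWith h m n ≡ handleWith h' m' n'
  handleWith-cong refl refl refl = refl

  handleWith-natural : {h : Hom Y (ℋ S S' X)} {m : Hom Y (T₀ S A)} {n : Hom (Y ⊗₀ A) (T₀ S' X)}
                       {k : Hom W Y}
                     → handleWith h m n ∘ k ≡ handleWith (h ∘ k) (m ∘ k) (n ∘ (k ⊗₁ id))
  handleWith-natural {S = S} {h = h} {k = k} =
    pullʳ (trans ⟨⟩∘ (cong ⟨ h ∘ k ,_⟩ (Monad.map-natural S)))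

  handleWith-return : {h : Hom Y (ℋ S S' X)} {v : Hom Y A} {n : Hom (Y ⊗₀ A) (T₀ S' X)}
                    → handleWith h (Monad.η S ∘ v) n ≡ n ∘ ⟨ id , v ⟩
  handleWith-return {S = S} {S'} {X} {h = h} {v} {n} = begin
    hd ∘ ⟨ h , map (η ∘ v) n ⟩                ≡⟨ refl⟩∘⟨ cong₂ ⟨_,_⟩ refl map-η ⟩
    hd ∘ ⟨ h , η ∘ n ∘ ⟨ id , v ⟩ ⟩           ≡⟨ refl⟩∘⟨ second∘⟨⟩ ⟨
    hd ∘ (id ⊗₁ η) ∘ ⟨ h , n ∘ ⟨ id , v ⟩ ⟩   ≡⟨ pullˡ handle-η ⟩
    π₂ ∘ ⟨ h , n ∘ ⟨ id , v ⟩ ⟩               ≡⟨ π₂-β ⟩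
    n ∘ ⟨ id , v ⟩                            ∎
    where
    open Monad S using (η; map; map-η)
    hd = handle S S' X

  handleWith-bind : {h : Hom Y (ℋ S S' X)} {l : Hom Y (T₀ S A)} {m : Hom (Y ⊗₀ A) (T₀ S B)}
                    {n : Hom (Y ⊗₀ B) (T₀ S' X)}
                  → handleWith h (Monad.bind S l m) n
                    ≡ handleWith h l (handleWith (h ∘ π₁) m (n ∘ (π₁ ⊗₁ id)))
  handleWith-bind {S = S} {S'} {X} {h = h} {l} {m} {n} = begin
    hd ∘ ⟨ h , map (bind l m) n ⟩
      ≡⟨ refl⟩∘⟨ cong₂ ⟨_,_⟩ refl map-bind ⟩
    hd ∘ ⟨ h , μ ∘ map l k ⟩
      ≡⟨ refl⟩∘⟨ second∘⟨⟩ ⟨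
    hd ∘ (id ⊗₁ μ) ∘ ⟨ h , map l k ⟩
      ≡⟨ trans (pullˡ handle-μ) (trans assoc (refl⟩∘⟨ assoc)) ⟩
    hd ∘ (id ⊗₁ T₁ hd) ∘ ⟨ π₁ , st ⟩ ∘ ⟨ h , map l k ⟩
      ≡⟨ refl⟩∘⟨ refl⟩∘⟨ trans ⟨⟩∘ (cong₂ ⟨_,_⟩ π₁-β refl) ⟩
    hd ∘ (id ⊗₁ T₁ hd) ∘ ⟨ h , st ∘ ⟨ h , map l k ⟩ ⟩
      ≡⟨ refl⟩∘⟨ refl⟩∘⟨ cong₂ ⟨_,_⟩ refl st∘⟨-,map⟩ ⟩
    hd ∘ (id ⊗₁ T₁ hd) ∘ ⟨ h , map l ⟨ h ∘ π₁ , k ⟩ ⟩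
      ≡⟨ refl⟩∘⟨ trans second∘⟨⟩ (cong₂ ⟨_,_⟩ refl T₁∘map) ⟩
    hd ∘ ⟨ h , map l (hd ∘ ⟨ h ∘ π₁ , k ⟩) ⟩
      ∎
    where
    open Monad S using (T₁; μ; st; map; bind; map-bind; st∘⟨-,map⟩; T₁∘map)
    hd = handle S S' X
    k = map m (n ∘ (π₁ ⊗₁ id))

  handleWith-op : ∀ {o} {h : Hom Y (ℋ S S' X)} (p : S ∋ (o ∶ A ⟶ₛ B)) {v : Hom Y A}
                  {n : Hom (Y ⊗₀ B) (T₀ S' X)}
                → handleWith h (⟦op⟧ S p ∘ v) n
                  ≡ Exponential.ev S' ∘ ⟨ πℋ p ∘ h , ⟨ v , Exponential.Λ S' n ⟩ ⟩
  handleWith-op {S = S} {S'} {X} {h = h} p {v} {n} = begin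
    hd ∘ ⟨ h , map (op ∘ v) n ⟩                ≡⟨ refl⟩∘⟨ cong₂ ⟨_,_⟩ refl map≡a-op ⟩
    hd ∘ ⟨ h , a-op p ∘ ⟨ v , Λ n ⟩ ⟩          ≡⟨ refl⟩∘⟨ second∘⟨⟩ ⟨
    hd ∘ (id ⊗₁ a-op p) ∘ ⟨ h , ⟨ v , Λ n ⟩ ⟩  ≡⟨ pullˡ (handle-op p) ⟩
    (ev ∘ (πℋ p ⊗₁ id)) ∘ ⟨ h , ⟨ v , Λ n ⟩ ⟩  ≡⟨ pullʳ first∘⟨⟩ ⟩
    ev ∘ ⟨ πℋ p ∘ h , ⟨ v , Λ n ⟩ ⟩            ∎
    where
    open Monad S using (T₁; st; map; map-⊗₁)
    open Exponential S' using (ev; Λ; Λ-β)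
    hd = handle S S' X
    op = ⟦op⟧ S p
    map≡a-op : map (op ∘ v) n ≡ a-op p ∘ ⟨ v , Λ n ⟩
    map≡a-op = begin
      T₁ n ∘ st ∘ ⟨ id , op ∘ v ⟩                   ≡⟨ cong (λ q → T₁ q ∘ st ∘ ⟨ id , op ∘ v ⟩) Λ-β ⟨
      T₁ (ev ∘ (Λ n ⊗₁ id)) ∘ st ∘ ⟨ id , op ∘ v ⟩  ≡⟨ map-⊗₁ ⟩
      T₁ ev ∘ st ∘ ⟨ Λ n , op ∘ v ⟩                 ≡⟨ refl⟩∘⟨ refl⟩∘⟨ trans (refl⟩∘⟨ first∘⟨⟩) swap∘⟨⟩ ⟨
      T₁ ev ∘ st ∘ swap ∘ (op ⊗₁ id) ∘ ⟨ v , Λ n ⟩  ≡⟨ pullʳ (pullʳ assoc) ⟨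
      a-op p ∘ ⟨ v , Λ n ⟩                          ∎

module Soundness {o ℓ : Level} (𝓜 : Model o ℓ) where
  open Model 𝓜
  open Interp 𝓜
  open ModelProperties 𝓜
  open ≡-Reasoning

  private variable
    Γ Δ : Ctx
    A B D : VTy
    As : List VTy
    C : CTy
    Σ Σ' : Sig

  DenotesRen : Hom ⟦ Δ ⟧ctx ⟦ Γ ⟧ctx → Ren Γ Δ → Set ℓ
  DenotesRen {Γ = Γ} r ρ = ∀ {A} (x : Γ ∋ A) → ⟦ ρ x ⟧var ≡ ⟦ x ⟧var ∘ r

  DenotesSub : Hom ⟦ Δ ⟧ctx ⟦ Γ ⟧ctx → Sub Γ Δ → Set ℓ
  DenotesSub {Γ = Γ} s σ = ∀ {A} (x : Γ ∋ A) → ⟦ σ x ⟧v ≡ ⟦ x ⟧var ∘ s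

  there-denotes : ∀ A → DenotesRen π₁ (there {y = A} {xs = Γ})
  there-denotes A x = refl

  ext-denotes : {r : Hom ⟦ Δ ⟧ctx ⟦ Γ ⟧ctx} {ρ : Ren Γ Δ}
              → DenotesRen r ρ → DenotesRen (r ⊗₁ id) (ext {B = B} ρ)
  ext-denotes d here      = sym π₂∘first
  ext-denotes d (there x) = trans (cong (_∘ π₁) (d x)) (trans assoc (sym (pullʳ π₁-β)))

  ext-there-denotes : ∀ A → DenotesRen (π₁ ⊗₁ id) (ext {B = B} (there {y = A} {xs = Γ}))
  ext-there-denotes A = ext-denotes (there-denotes A)

  mutual
    ⟦renV⟧ : {r : Hom ⟦ Δ ⟧ctx ⟦ Γ ⟧ctx} {ρ : Ren Γ Δ}
           → DenotesRen r ρ → (V : Val Γ A) → ⟦ renV ρ V ⟧v ≡ ⟦ V ⟧v ∘ r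
    ⟦renV⟧ d (var x)             = d x
    ⟦renV⟧ d (lam {C = _ ! _} M) =
      trans (cong (Exponential.Λ _) (⟦renC⟧ (ext-denotes d) M)) (sym (Exponential.Λ-natural _))
    ⟦renV⟧ d (tuple Vs)          = ⟦renVs⟧ d Vs
    ⟦renV⟧ d (proj i V)          = pushʳ (⟦renV⟧ d V)

    ⟦renVs⟧ : {r : Hom ⟦ Δ ⟧ctx ⟦ Γ ⟧ctx} {ρ : Ren Γ Δ}
            → DenotesRen r ρ → (Vs : Vals Γ As) → ⟦ renVs ρ Vs ⟧vs ≡ ⟦ Vs ⟧vs ∘ r
    ⟦renVs⟧ d []       = sym (!-unique _)
    ⟦renVs⟧ d (V ∷ Vs) = trans (cong₂ ⟨_,_⟩ (⟦renV⟧ d V) (⟦renVs⟧ d Vs)) (sym ⟨⟩∘)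

    ⟦renC⟧ : {r : Hom ⟦ Δ ⟧ctx ⟦ Γ ⟧ctx} {ρ : Ren Γ Δ}
           → DenotesRen r ρ → (M : Comp Γ C) → ⟦ renC ρ M ⟧c ≡ ⟦ M ⟧c ∘ r
    ⟦renC⟧ d (app {C = _ ! _} V W) = pushʳ (trans (cong₂ ⟨_,_⟩ (⟦renV⟧ d V) (⟦renV⟧ d W)) (sym ⟨⟩∘))
    ⟦renC⟧ d (ret V)               = pushʳ (⟦renV⟧ d V)
    ⟦renC⟧ d (letin M N)           =
      trans (cong₂ (Monad.bind _) (⟦renC⟧ d M) (⟦renC⟧ (ext-denotes d) N)) (sym (Monad.bind-natural _))
    ⟦renC⟧ d (opr p V)             = pushʳ (⟦renV⟧ d V)
    ⟦renC⟧ d (handleC {C = _ ! _} M H N) =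
      trans (handleWith-cong (⟦renH⟧ d H) (⟦renC⟧ d M) (⟦renC⟧ (ext-denotes d) N))
            (sym handleWith-natural)

    ⟦renH⟧ : {r : Hom ⟦ Δ ⟧ctx ⟦ Γ ⟧ctx} {ρ : Ren Γ Δ}
           → DenotesRen r ρ → (H : Hdl Γ Σ (A ! Σ')) → ⟦ renH ρ H ⟧h ≡ ⟦ H ⟧h ∘ r
    ⟦renH⟧ d ∅            = sym (!-unique _)
    ⟦renH⟧ d (clause M H) =
      trans (cong₂ ⟨_,_⟩ (trans (cong (Exponential.Λ₂ _) (⟦renC⟧ (ext-denotes (ext-denotes d)) M))
                                (sym (Exponential.Λ₂-natural _)))
                         (⟦renH⟧ d H))
            (sym ⟨⟩∘)

  exts-denotes : {s : Hom ⟦ Δ ⟧ctx ⟦ Γ ⟧ctx} {σ : Sub Γ Δ}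
               → DenotesSub s σ → DenotesSub (s ⊗₁ id) (exts {B = B} σ)
  exts-denotes d here                      = sym π₂∘first
  exts-denotes {B = B} {σ = σ} d (there x) =
    trans (⟦renV⟧ (there-denotes B) (σ x)) (trans (cong (_∘ π₁) (d x)) (trans assoc (sym (pullʳ π₁-β))))

  mutual
    ⟦subV⟧ : {s : Hom ⟦ Δ ⟧ctx ⟦ Γ ⟧ctx} {σ : Sub Γ Δ}
           → DenotesSub s σ → (V : Val Γ A) → ⟦ subV σ V ⟧v ≡ ⟦ V ⟧v ∘ s
    ⟦subV⟧ d (var x)             = d x
    ⟦subV⟧ d (lam {C = _ ! _} M) =
      trans (cong (Exponential.Λ _) (⟦subC⟧ (exts-denotes d) M)) (sym (Exponential.Λ-natural _))
    ⟦subV⟧ d (tuple Vs)          = ⟦subVs⟧ d Vs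
    ⟦subV⟧ d (proj i V)          = pushʳ (⟦subV⟧ d V)

    ⟦subVs⟧ : {s : Hom ⟦ Δ ⟧ctx ⟦ Γ ⟧ctx} {σ : Sub Γ Δ}
            → DenotesSub s σ → (Vs : Vals Γ As) → ⟦ subVs σ Vs ⟧vs ≡ ⟦ Vs ⟧vs ∘ s
    ⟦subVs⟧ d []       = sym (!-unique _)
    ⟦subVs⟧ d (V ∷ Vs) = trans (cong₂ ⟨_,_⟩ (⟦subV⟧ d V) (⟦subVs⟧ d Vs)) (sym ⟨⟩∘)

    ⟦subC⟧ : {s : Hom ⟦ Δ ⟧ctx ⟦ Γ ⟧ctx} {σ : Sub Γ Δ}
           → DenotesSub s σ → (M : Comp Γ C) → ⟦ subC σ M ⟧c ≡ ⟦ M ⟧c ∘ s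
    ⟦subC⟧ d (app {C = _ ! _} V W) = pushʳ (trans (cong₂ ⟨_,_⟩ (⟦subV⟧ d V) (⟦subV⟧ d W)) (sym ⟨⟩∘))
    ⟦subC⟧ d (ret V)               = pushʳ (⟦subV⟧ d V)
    ⟦subC⟧ d (letin M N)           =
      trans (cong₂ (Monad.bind _) (⟦subC⟧ d M) (⟦subC⟧ (exts-denotes d) N)) (sym (Monad.bind-natural _))
    ⟦subC⟧ d (opr p V)             = pushʳ (⟦subV⟧ d V)
    ⟦subC⟧ d (handleC {C = _ ! _} M H N) =
      trans (handleWith-cong (⟦subH⟧ d H) (⟦subC⟧ d M) (⟦subC⟧ (exts-denotes d) N))
            (sym handleWith-natural)

    ⟦subH⟧ : {s : Hom ⟦ Δ ⟧ctx ⟦ Γ ⟧ctx} {σ : Sub Γ Δ}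
           → DenotesSub s σ → (H : Hdl Γ Σ (A ! Σ')) → ⟦ subH σ H ⟧h ≡ ⟦ H ⟧h ∘ s
    ⟦subH⟧ d ∅            = sym (!-unique _)
    ⟦subH⟧ d (clause M H) =
      trans (cong₂ ⟨_,_⟩ (trans (cong (Exponential.Λ₂ _) (⟦subC⟧ (exts-denotes (exts-denotes d)) M))
                                (sym (Exponential.Λ₂-natural _)))
                         (⟦subH⟧ d H))
            (sym ⟨⟩∘)

  ⟦[]⟧ : (M : Comp (A ∷ Γ) C) (V : Val Γ A) → ⟦ M [ V ] ⟧c ≡ ⟦ M ⟧c ∘ ⟨ id , ⟦ V ⟧v ⟩
  ⟦[]⟧ M V = ⟦subC⟧ (λ { here      → sym π₂-β
                       ; (there x) → sym (trans (pullʳ π₁-β) identityʳ) }) M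

  ⟦[,]⟧ : (M : Comp ((B ⇒ C) ∷ A ∷ Γ) C) (V : Val Γ A) (K : Val Γ (B ⇒ C))
        → ⟦ M [ V , K ] ⟧c ≡ ⟦ M ⟧c ∘ ⟨ ⟨ id , ⟦ V ⟧v ⟩ , ⟦ K ⟧v ⟩
  ⟦[,]⟧ M V K = ⟦subC⟧ (λ { here              → sym π₂-β
                          ; (there here)      → sym (trans (pullʳ π₁-β) π₂-β)
                          ; (there (there x)) →
                              sym (trans (pullʳ π₁-β) (trans (pullʳ π₁-β) identityʳ)) }) M

  ⟦lookupVs⟧ : (Vs : Vals Γ As) (i : As ∋ A) → ⟦ i ⟧proj ∘ ⟦ Vs ⟧vs ≡ ⟦ lookupVs Vs i ⟧v
  ⟦lookupVs⟧ (V ∷ Vs) here      = π₁-β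
  ⟦lookupVs⟧ (V ∷ Vs) (there i) = trans (pullʳ π₂-β) (⟦lookupVs⟧ Vs i)

  ⟦tabulateVs⟧ : ∀ As (f : ∀ {A} → As ∋ A → Val Γ A) {g : Hom ⟦ Γ ⟧ctx ⟦ As ⟧tys}
               → (∀ {A} (i : As ∋ A) → ⟦ f i ⟧v ≡ ⟦ i ⟧proj ∘ g) → ⟦ tabulateVs As f ⟧vs ≡ g
  ⟦tabulateVs⟧ []       f e = sym (!-unique _)
  ⟦tabulateVs⟧ (A ∷ As) f e =
    trans (cong₂ ⟨_,_⟩ (e here) (⟦tabulateVs⟧ As (λ i → f (there i)) (λ i → trans (e (there i)) assoc)))
          ⟨⟩-η

  ⟦lookupH⟧ : ∀ {o} (H : Hdl Γ Σ (D ! Σ')) (p : Σ ∋ (o ∶ A ⟶ B))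
            → πℋ ⟦ p ⟧∋ ∘ ⟦ H ⟧h ≡ Exponential.Λ₂ ⟦ Σ' ⟧sig ⟦ lookupH H p ⟧c
  ⟦lookupH⟧ (clause M H) here      = π₁-β
  ⟦lookupH⟧ (clause M H) (there p) = trans (pullʳ π₂-β) (⟦lookupH⟧ H p)

  ⟦Handle-Op⟧ : ∀ {o} (p : Σ ∋ (o ∶ A ⟶ B)) (V : Val Γ A) (H : Hdl Γ Σ (D ! Σ'))
                (N : Comp (B ∷ Γ) (D ! Σ'))
              → ⟦ handleC (opr p V) H N ⟧c ≡ ⟦ lookupH H p [ V , lam N ] ⟧c
  ⟦Handle-Op⟧ {Σ' = Σ'} p V H N = begin
    handleWith ⟦ H ⟧h (⟦op⟧ _ ⟦ p ⟧∋ ∘ ⟦ V ⟧v) ⟦ N ⟧c    ≡⟨ handleWith-op ⟦ p ⟧∋ ⟩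
    ev ∘ ⟨ πℋ ⟦ p ⟧∋ ∘ ⟦ H ⟧h , ⟨ ⟦ V ⟧v , Λ ⟦ N ⟧c ⟩ ⟩  ≡⟨ refl⟩∘⟨ cong₂ ⟨_,_⟩ (⟦lookupH⟧ H p) refl ⟩
    ev ∘ ⟨ Λ₂ ⟦ lookupH H p ⟧c , ⟨ ⟦ V ⟧v , Λ ⟦ N ⟧c ⟩ ⟩ ≡⟨ ev∘⟨Λ₂,-⟩ ⟩
    ⟦ lookupH H p ⟧c ∘ ⟨ ⟨ id , ⟦ V ⟧v ⟩ , Λ ⟦ N ⟧c ⟩    ≡⟨ ⟦[,]⟧ (lookupH H p) V (lam N) ⟨
    ⟦ lookupH H p [ V , lam N ] ⟧c                    ∎
    where
    open Exponential ⟦ Σ' ⟧sig using (ev; Λ; Λ₂; ev∘⟨Λ₂,-⟩)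

  mutual
    ≈v-sound : {V W : Val Γ A} → V ≈v W → ⟦ V ⟧v ≡ ⟦ W ⟧v
    ≈v-sound ≈v-refl                   = refl
    ≈v-sound (≈v-sym e)                = sym (≈v-sound e)
    ≈v-sound (≈v-trans e e')           = trans (≈v-sound e) (≈v-sound e')
    ≈v-sound (lam-cong {C = _ ! _} e)  = cong (Exponential.Λ _) (≈c-sound e)
    ≈v-sound (tuple-cong e)            = ≈vs-sound e
    ≈v-sound (proj-cong i e)           = cong (⟦ i ⟧proj ∘_) (≈v-sound e)
    ≈v-sound (fun-η {A} {C = _ ! _} V) =
      trans (cong (λ v → Exponential.Λ _ (Exponential.ev _ ∘ ⟨ v , π₂ ⟩)) (⟦renV⟧ (there-denotes A) V))
            (Exponential.Λ-η′ _)
    ≈v-sound (prod-β Vs i)             = ⟦lookupVs⟧ Vs i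
    ≈v-sound (prod-η {As} V)           = ⟦tabulateVs⟧ As (λ i → proj i V) (λ i → refl)

    ≈vs-sound : {Vs Ws : Vals Γ As} → Vs ≈vs Ws → ⟦ Vs ⟧vs ≡ ⟦ Ws ⟧vs
    ≈vs-sound []       = refl
    ≈vs-sound (e ∷ es) = cong₂ ⟨_,_⟩ (≈v-sound e) (≈vs-sound es)

    ≈c-sound : {M N : Comp Γ C} → M ≈c N → ⟦ M ⟧c ≡ ⟦ N ⟧c
    ≈c-sound ≈c-refl                     = refl
    ≈c-sound (≈c-sym e)                  = sym (≈c-sound e)
    ≈c-sound (≈c-trans e e')             = trans (≈c-sound e) (≈c-sound e')
    ≈c-sound (app-cong {C = _ ! _} e e') = refl⟩∘⟨ cong₂ ⟨_,_⟩ (≈v-sound e) (≈v-sound e')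
    ≈c-sound (ret-cong e)                = refl⟩∘⟨ ≈v-sound e
    ≈c-sound (letin-cong e e')           = cong₂ (Monad.bind _) (≈c-sound e) (≈c-sound e')
    ≈c-sound (opr-cong p e)              = refl⟩∘⟨ ≈v-sound e
    ≈c-sound (handle-cong {C = _ ! _} e eₕ e') =
      handleWith-cong (≈h-sound eₕ) (≈c-sound e) (≈c-sound e')
    ≈c-sound (fun-β {C = _ ! _} M V)     = trans (Exponential.ev∘⟨Λ,-⟩ _) (sym (⟦[]⟧ M V))
    ≈c-sound (let-β V N)                 = trans (Monad.bind-identityˡ _) (sym (⟦[]⟧ N V))
    ≈c-sound (let-η M)                   = Monad.bind-identityʳ _
    ≈c-sound (let-assoc {A} L M N)       =
      trans (Monad.bind-assoc _)
            (cong (λ n → Monad.bind _ ⟦ L ⟧c (Monad.bind _ ⟦ M ⟧c n))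
                  (sym (⟦renC⟧ (ext-there-denotes A) N)))
    ≈c-sound (Handle-Ret {C = _ ! _} V H N) = trans handleWith-return (sym (⟦[]⟧ N V))
    ≈c-sound (Handle-Let {A} {C = _ ! _} L M H N) =
      trans handleWith-bind
            (cong₂ (λ h n → handleWith ⟦ H ⟧h ⟦ L ⟧c (handleWith h ⟦ M ⟧c n))
                   (sym (⟦renH⟧ (there-denotes A) H)) (sym (⟦renC⟧ (ext-there-denotes A) N)))
    ≈c-sound (Handle-Op {C = _ ! _} p V H N) = ⟦Handle-Op⟧ p V H N

    ≈h-sound : {H H' : Hdl Γ Σ (A ! Σ')} → H ≈h H' → ⟦ H ⟧h ≡ ⟦ H' ⟧h
    ≈h-sound ≈h-refl            = refl
    ≈h-sound (≈h-sym e)         = sym (≈h-sound e)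
    ≈h-sound (≈h-trans e e')    = trans (≈h-sound e) (≈h-sound e')
    ≈h-sound (clause-cong e e') = cong₂ ⟨_,_⟩ (cong (Exponential.Λ₂ _) (≈c-sound e)) (≈h-sound e')

theorem4p4 : ∀ {o ℓ : Level} (𝓜 : Model o ℓ)
    → (∀ {Γ A} {V W : Val Γ A} → V ≈v W → Interp.⟦_⟧v 𝓜 V ≡ Interp.⟦_⟧v 𝓜 W)
    × (∀ {Γ C} {M N : Comp Γ C} → M ≈c N → Interp.⟦_⟧c 𝓜 M ≡ Interp.⟦_⟧c 𝓜 N)
    × (∀ {Γ Σ A Σ'} {H H' : Hdl Γ Σ (A ! Σ')} → H ≈h H'
       → Interp.⟦_⟧h 𝓜 H ≡ Interp.⟦_⟧h 𝓜 H')
theorem4p4 𝓜 = ≈v-sound , ≈c-sound , ≈h-sound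
  where
  open Soundness 𝓜
  open import Data.Product using (_,_)
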